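{- Let $x$ be any sequence of signs $\pm1$ of length $a$, and let $P_x$ be the distribution on $S_n$ of an $x$-shuffle of $n$ cards. Then \[ \operatorname{sep}(P_x)\le 1-\prod_{i=1}^{n-1}\left(1-\frac{i}{a}\right). \]
   Context: For a sign sequence $x=(x_1,\dots,x_a)$, the $x$-shuffle of a deck of $n$ cards is: cut the deck, from the top, into $a$ consecutive packets with multinomial sizes (as $n$ balls dropped independently and uniformly into $a$ boxes), reverse packet $i$ whenever $x_i=-1$, then interleave the packets so that all interleavings preserving order within each packet are equally likely; $P_x$ is the resulting distribution on $S_n$. For a probability $P$ on $S_n$ with $U$ the uniform distribution, the separation distance is $\operatorname{sep}(P)=\max_{w\in S_n}\left(1-\frac{P(w)}{U(w)}\right)$. -}

module Defs where

open import Data.Nat as ℕ using (ℕ; zero; suc)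
open import Data.Nat using (_!)
import Data.Vec.Properties as VecP
open import Data.Fin as Fin using (Fin)
open import Data.Vec as Vec using (Vec; []; _∷_)
open import Data.List as List using (List; []; _∷_; _++_; length; filter; upTo; concatMap; reverse; take; drop)
open import Data.List.Properties using (≡-dec)
open import Data.Sign using (Sign)
open import Data.Integer using (+_)
open import Data.Rational using (ℚ; 0ℚ; 1ℚ; _/_; _*_; _+_; _-_; _⊔_)
open import Relation.Nullary.Decidable using (does)
open import Data.Bool using (if_then_else_)
import Data.List.Relation.Unary.Unique.DecPropositional as UDec

-- m / d as a rational, with the (never used) convention m / 0 = 0
frac : ℕ → ℕ → ℚ
frac m zero    = 0ℚ
frac m (suc d) = (+ m) / suc d

sumℚ : List ℚ → ℚ
sumℚ = List.foldr _+_ 0ℚ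

prodℚ : List ℚ → ℚ
prodℚ = List.foldr _*_ 1ℚ

-- all words of length n over the alphabet Fin a (all functions Fin n → Fin a)
words : (a n : ℕ) → List (Vec (Fin a) n)
words a zero    = [] ∷ []
words a (suc n) = concatMap (λ i → List.map (i ∷_) (words a n)) (List.allFin a)

occ : ∀ {a n} → Fin a → Vec (Fin a) n → ℕ
occ i v = length (filter (λ j → j Fin.≟ i) (Vec.toList v))

-- box sizes / letter counts of a word
counts : ∀ {a n} → Vec (Fin a) n → Vec ℕ a
counts {a} v = Vec.tabulate (λ i → occ i v)

-- A deck of n cards is labelled 0,…,n-1 from top to bottom.
-- An arrangement lists the cards from top to bottom.
deck : (n : ℕ) → List (Fin n)
deck n = List.allFin n

Sn : (n : ℕ) → List (List (Fin n))
Sn n = filter (UDec.unique? Fin._≟_) (List.map Vec.toList (words n n))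

cut : ∀ {A : Set} {a} → Vec ℕ a → List A → Vec (List A) a
cut []       xs = []
cut (c ∷ cs) xs = take c xs ∷ cut cs (drop c xs)

orient : ∀ {A : Set} → Sign → List A → List A
orient Sign.- p = reverse p
orient Sign.+ p = p

-- interleave packets according to a word s: position j of the
-- resulting deck (from the top) takes the next card of packet s_j
interleave : ∀ {A : Set} {a n} → Vec (List A) a → Vec (Fin a) n → List A
interleave ps []      = []
interleave ps (i ∷ s) with Vec.lookup ps i
... | []      = interleave ps s
... | c ∷ cs  = c ∷ interleave (ps Vec.[ i ]≔ cs) s

packets : ∀ {a} (n : ℕ) → Vec Sign a → Vec ℕ a → Vec (List (Fin n)) a
packets n x c = Vec.zipWith orient x (cut c (deck n))

-- interleavings compatible with packet sizes c (multinomially many; uniform)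
interleavings : ∀ {a} (n : ℕ) → Vec ℕ a → List (Vec (Fin a) n)
interleavings {a} n c = filter (λ s → VecP.≡-dec ℕ._≟_ (counts s) c) (words a n)

Qint : ∀ {a} (n : ℕ) → Vec Sign a → Vec ℕ a → List (Fin n) → ℚ
Qint n x c w =
  frac (length (filter (λ s → ≡-dec Fin._≟_ (interleave (packets n x c) s) w)
                       (interleavings n c)))
       (length (interleavings n c))

-- P_x(w): the n cards are dropped independently and uniformly into a boxes
-- (each f : Fin n → Fin a has probability 1/a^n), the box counts give the
-- packet sizes, then packets are oriented and uniformly interleaved.
Px : ∀ {a} (n : ℕ) → Vec Sign a → List (Fin n) → ℚ
Px {a} n x w = sumℚ (List.map (λ f → frac 1 (a ℕ.^ n) * Qint n x (counts f) w) (words a n))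

U : (n : ℕ) → List (Fin n) → ℚ
U n w = frac 1 (n !)

-- maximum of a nonempty list (0 on the empty list; S_n is never empty)
maxℚ : List ℚ → ℚ
maxℚ []       = 0ℚ
maxℚ (q ∷ qs) = List.foldr _⊔_ q qs

-- separation distance sep(P) = max_{w ∈ S_n} (1 - P(w)/U(w)),
-- with P(w)/U(w) written as P(w) · n!  (since U(w) = 1/n!)
sep : (n : ℕ) → (List (Fin n) → ℚ) → ℚ
sep n P = maxℚ (List.map (λ w → 1ℚ - P w * frac (n !) 1) (Sn n))

bound : (a n : ℕ) → ℚ
bound a n = 1ℚ - prodℚ (List.map (λ i → 1ℚ - frac i a) (drop 1 (upTo n)))

module Submission where

-- Since sep(P_x) = max_w (1 - n!·P_x(w)), it suffices to show n!·P_x(w) ≥ ∏ (1 - i/a)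
-- for every arrangement w.  Call a drop f of the n cards into the a boxes injective if
-- no box receives two cards.  After an injective drop every nonempty packet is a single
-- card.  There are
-- at most n! interleavings (a multinomial coefficient), so each injective drop
-- contributes at least a⁻ⁿ · (1/n!) to P_x(w).  There are at least a(a-1)⋯(a-n+1)
-- injective drops, hence n!·P_x(w) ≥ a(a-1)⋯(a-n+1)/aⁿ = ∏_{i=0}^{n-1} (1 - i/a).

open import Defs
open import Data.Nat as ℕ using (ℕ; zero; suc; NonZero)
open import Data.Fin as Fin using (Fin)
open import Data.Vec as Vec using (Vec; []; _∷_)
open import Data.List as List using (List; []; _∷_; _++_; length; filter; concatMap)
open import Data.List.Membership.Propositional using (_∈_; _∉_)
open import Data.List.Relation.Unary.Any as Any using (here; there)
open import Data.List.Relation.Unary.All as All using (All; []; _∷_)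
open import Data.List.Relation.Unary.AllPairs using (AllPairs; []; _∷_)
open import Data.Sign using (Sign)
open import Data.Product using (Σ; _,_; proj₁; proj₂)
open import Data.Bool using (true; false; if_then_else_)
open import Relation.Nullary using (Dec; yes; no; does; ¬_; ¬?)
open import Relation.Unary using (Decidable)
open import Relation.Binary.PropositionalEquality
open import Data.Empty using (⊥-elim)
open import Function using (_∘_)

count : ∀ {A : Set} {P : A → Set} → Decidable P → List A → ℕ
count P? l = length (filter P? l)

Distinct : ∀ {a} → List (Fin a) → Set
Distinct = AllPairs _≢_

falling : ℕ → ℕ → ℕ
falling m zero    = 1
falling m (suc n) = m ℕ.* falling (ℕ.pred m) n

module Combinatorics where

  open import Data.Nat using (_+_; _*_; _∸_; _!; _≤_; z≤n; s≤s)
  open import Data.Nat.Properties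
  open import Algebra.Properties.CommutativeSemigroup +-commutativeSemigroup using (interchange)
  import Data.Vec.Properties as VecP
  open import Data.Sum using (_⊎_; inj₁; inj₂)
  open import Data.List.Properties
    using (≡-dec; ∷-injectiveˡ; filter-++; length-++; filter-none; filter-some; length-filter;
           ++-assoc; ++-identityʳ; length-take; length-reverse; take-all; length-tabulate)
  open import Data.List.Membership.Propositional.Properties
    using (∈-allFin; ∈-map⁺; ∈-map⁻; ∈-concatMap⁺; ∈-filter⁺; ∈-filter⁻)
  import Data.List.Relation.Unary.AllPairs.Properties as AllPairsP
  import Data.List.Relation.Unary.Unique.Propositional.Properties as UniqueP
  import Data.List.Relation.Unary.Unique.DecPropositional as UniqueDec

  indicator : ∀ {P : Set} → Dec P → ℕ
  indicator d = if does d then 1 else 0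

  ∑ : (a : ℕ) → (Fin a → ℕ) → ℕ
  ∑ zero    g = 0
  ∑ (suc a) g = g Fin.zero + ∑ a (g ∘ Fin.suc)

  ∑-cong : ∀ a {g h : Fin a → ℕ} → (∀ i → g i ≡ h i) → ∑ a g ≡ ∑ a h
  ∑-cong zero    g≡h = refl
  ∑-cong (suc a) g≡h = cong₂ _+_ (g≡h Fin.zero) (∑-cong a (g≡h ∘ Fin.suc))

  ∑-mono : ∀ a {g h : Fin a → ℕ} → (∀ i → g i ≤ h i) → ∑ a g ≤ ∑ a h
  ∑-mono zero    g≤h = z≤n
  ∑-mono (suc a) g≤h = +-mono-≤ (g≤h Fin.zero) (∑-mono a (g≤h ∘ Fin.suc))

  ∑-+ : ∀ a (g h : Fin a → ℕ) → ∑ a (λ i → g i + h i) ≡ ∑ a g + ∑ a h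
  ∑-+ zero    g h = refl
  ∑-+ (suc a) g h =
    trans (cong (g Fin.zero + h Fin.zero +_) (∑-+ a (g ∘ Fin.suc) (h ∘ Fin.suc)))
          (interchange (g Fin.zero) (h Fin.zero) _ _)

  ∑-*ʳ : ∀ a (g : Fin a → ℕ) m → ∑ a (λ i → g i * m) ≡ ∑ a g * m
  ∑-*ʳ zero    g m = refl
  ∑-*ʳ (suc a) g m = trans (cong (g Fin.zero * m +_) (∑-*ʳ a (g ∘ Fin.suc) m))
                           (sym (*-distribʳ-+ m (g Fin.zero) _))

  ∑-zero : ∀ a {g : Fin a → ℕ} → (∀ i → g i ≡ 0) → ∑ a g ≡ 0
  ∑-zero zero    g≡0 = refl
  ∑-zero (suc a) g≡0 = cong₂ _+_ (g≡0 Fin.zero) (∑-zero a (g≡0 ∘ Fin.suc))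

  ∑-ones : ∀ a → ∑ a (λ _ → 1) ≡ a
  ∑-ones zero    = refl
  ∑-ones (suc a) = cong suc (∑-ones a)

  ∑-indicator-≟ : ∀ a (i : Fin a) → ∑ a (λ j → indicator (i Fin.≟ j)) ≡ 1
  ∑-indicator-≟ (suc a) Fin.zero    = cong suc (∑-zero a (λ _ → refl))
  ∑-indicator-≟ (suc a) (Fin.suc i) = ∑-indicator-≟ a i

  ∑-≥-count : ∀ a {P : Fin a → Set} (P? : Decidable P) (g : Fin a → ℕ) m →
              (∀ i → P i → m ≤ g i) → ∑ a (λ i → indicator (P? i)) * m ≤ ∑ a g
  ∑-≥-count zero    P? g m m≤g = z≤n
  ∑-≥-count (suc a) P? g m m≤g with P? Fin.zero
  ... | yes p = +-mono-≤ (m≤g Fin.zero p) (∑-≥-count a (P? ∘ Fin.suc) (g ∘ Fin.suc) m (m≤g ∘ Fin.suc))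
  ... | no _  = ≤-trans (∑-≥-count a (P? ∘ Fin.suc) (g ∘ Fin.suc) m (m≤g ∘ Fin.suc))
                        (m≤n+m _ (g Fin.zero))

  ∑-≤-≡ : ∀ a {g h : Fin a → ℕ} → (∀ i → g i ≤ h i) → ∑ a g ≡ ∑ a h → ∀ i → g i ≡ h i
  ∑-≤-≡ (suc a) {g} g≤h sums i with m≤n⇒m<n∨m≡n (g≤h Fin.zero)
  ... | inj₁ g0<h0 = ⊥-elim (<⇒≢ (+-mono-<-≤ g0<h0 (∑-mono a (g≤h ∘ Fin.suc))) sums)
  ... | inj₂ g0≡h0 with i
  ...   | Fin.zero  = g0≡h0
  ...   | Fin.suc j = ∑-≤-≡ a (g≤h ∘ Fin.suc)
                        (+-cancelˡ-≡ (g Fin.zero) _ _ (trans sums (cong (_+ _) (sym g0≡h0)))) j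

  module _ {A : Set} {P : A → Set} (P? : Decidable P) where

    count-++ : ∀ l m → count P? (l ++ m) ≡ count P? l + count P? m
    count-++ l m = trans (cong length (filter-++ P? l m)) (length-++ (filter P? l))

    count-none : ∀ {l} → All (¬_ ∘ P) l → count P? l ≡ 0
    count-none ¬P = cong length (filter-none P? ¬P)

    count-∈ : ∀ {x l} → x ∈ l → P x → 1 ≤ count P? l
    count-∈ x∈l Px = filter-some P? (Any.map (λ { refl → Px }) x∈l)

    count-≤-length : ∀ l → count P? l ≤ length l
    count-≤-length = length-filter P?

  count-mono : ∀ {A : Set} {P Q : A → Set} (P? : Decidable P) (Q? : Decidable Q) →
               (∀ x → P x → Q x) → ∀ l → count P? l ≤ count Q? l
  count-mono P? Q? P⇒Q [] = z≤n
  count-mono P? Q? P⇒Q (x ∷ l) with P? x | Q? x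
  ... | yes _  | yes _  = s≤s (count-mono P? Q? P⇒Q l)
  ... | yes Px | no ¬Qx = ⊥-elim (¬Qx (P⇒Q x Px))
  ... | no _   | yes _  = m≤n⇒m≤1+n (count-mono P? Q? P⇒Q l)
  ... | no _   | no _   = count-mono P? Q? P⇒Q l

  count-map : ∀ {A B : Set} {P : B → Set} (P? : Decidable P) (h : A → B) l →
              count P? (List.map h l) ≡ count (P? ∘ h) l
  count-map P? h []      = refl
  count-map P? h (x ∷ l) with does (P? (h x))
  ... | true  = cong suc (count-map P? h l)
  ... | false = count-map P? h l

  count-words-suc : ∀ {a n} {P : Vec (Fin a) (suc n) → Set} (P? : Decidable P) →
    count P? (words a (suc n)) ≡ ∑ a (λ i → count (λ s → P? (i ∷ s)) (words a n))
  count-words-suc {a} {n} P? = go a (λ i → i)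
    where
    prefixed : Fin a → List (Vec (Fin a) (suc n))
    prefixed i = List.map (i ∷_) (words a n)
    go : ∀ b (h : Fin b → Fin a) →
         count P? (concatMap prefixed (List.tabulate h))
         ≡ ∑ b (λ i → count (λ s → P? (h i ∷ s)) (words a n))
    go zero    h = refl
    go (suc b) h = begin
      count P? (prefixed (h Fin.zero) ++ concatMap prefixed (List.tabulate (h ∘ Fin.suc)))
        ≡⟨ count-++ P? (prefixed (h Fin.zero)) _ ⟩
      count P? (prefixed (h Fin.zero)) + count P? (concatMap prefixed (List.tabulate (h ∘ Fin.suc)))
        ≡⟨ cong₂ _+_ (count-map P? (h Fin.zero ∷_) (words a n)) (go b (h ∘ Fin.suc)) ⟩
      ∑ (suc b) (λ i → count (λ s → P? (h i ∷ s)) (words a n)) ∎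
      where open ≡-Reasoning

  ∈-words : ∀ {a n} (v : Vec (Fin a) n) → v ∈ words a n
  ∈-words []      = here refl
  ∈-words {a} {suc n} (i ∷ v) =
    ∈-concatMap⁺ (λ j → List.map (j ∷_) (words a n))
                 (Any.map (λ { refl → ∈-map⁺ (i ∷_) (∈-words v) }) (∈-allFin i))

  occurrences : ∀ {a} → Fin a → List (Fin a) → ℕ
  occurrences b l = length (filter (λ j → j Fin.≟ b) l)

  occurrences-∷ : ∀ {a} (b i : Fin a) l → occurrences b (i ∷ l) ≡ indicator (i Fin.≟ b) + occurrences b l
  occurrences-∷ b i l with does (i Fin.≟ b)
  ... | true  = refl
  ... | false = refl

  ∑-occurrences : ∀ {a} (l : List (Fin a)) → ∑ a (λ b → occurrences b l) ≡ length l
  ∑-occurrences {a} []      = ∑-zero a (λ _ → refl)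
  ∑-occurrences {a} (i ∷ l) = begin
    ∑ a (λ b → occurrences b (i ∷ l))
      ≡⟨ ∑-cong a (λ b → occurrences-∷ b i l) ⟩
    ∑ a (λ b → indicator (i Fin.≟ b) + occurrences b l)
      ≡⟨ ∑-+ a _ _ ⟩
    ∑ a (λ b → indicator (i Fin.≟ b)) + ∑ a (λ b → occurrences b l)
      ≡⟨ cong₂ _+_ (∑-indicator-≟ a i) (∑-occurrences l) ⟩
    suc (length l) ∎
    where open ≡-Reasoning

  occurrences-distinct : ∀ {a} (b : Fin a) l → Distinct l → occurrences b l ≤ 1
  occurrences-distinct b []      _             = z≤n
  occurrences-distinct b (x ∷ l) (x∉l ∷ dist) with x Fin.≟ b
  ... | yes refl = s≤s (≤-reflexive (count-none _ (All.map (λ x≢j j≡x → x≢j (sym j≡x)) x∉l)))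
  ... | no _     = occurrences-distinct b l dist

  occurrences-∈ : ∀ {a} (b : Fin a) l → 1 ≤ occurrences b l → b ∈ l
  occurrences-∈ b (x ∷ l) occ≥1 with x Fin.≟ b
  ... | yes refl = here refl
  ... | no _     = there (occurrences-∈ b l occ≥1)

  vec-ext : ∀ {A : Set} {m} (u v : Vec A m) → (∀ i → Vec.lookup u i ≡ Vec.lookup v i) → u ≡ v
  vec-ext u v u≗v = trans (sym (VecP.tabulate∘lookup u))
                          (trans (VecP.tabulate-cong u≗v) (VecP.tabulate∘lookup v))

  counts-lookup : ∀ {a n} (s : Vec (Fin a) n) b → Vec.lookup (counts s) b ≡ occ b s
  counts-lookup s b = VecP.lookup∘tabulate _ b

  total : ∀ {a} → Vec ℕ a → ℕ
  total {a} c = ∑ a (Vec.lookup c)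

  total-counts : ∀ {a n} (s : Vec (Fin a) n) → total (counts s) ≡ n
  total-counts {a} {n} s = begin
    ∑ a (Vec.lookup (counts s))                     ≡⟨ ∑-cong a (counts-lookup s) ⟩
    ∑ a (λ b → occurrences b (Vec.toList s))        ≡⟨ ∑-occurrences (Vec.toList s) ⟩
    length (Vec.toList s)                           ≡⟨ VecP.length-toList s ⟩
    n                                               ∎
    where open ≡-Reasoning

  indicator-≟-refl : ∀ {a} (i : Fin a) → indicator (i Fin.≟ i) ≡ 1
  indicator-≟-refl i with i Fin.≟ i
  ... | yes _   = refl
  ... | no i≢i = ⊥-elim (i≢i refl)

  indicator-≟-≢ : ∀ {a} {i j : Fin a} → i ≢ j → indicator (i Fin.≟ j) ≡ 0
  indicator-≟-≢ {i = i} {j} i≢j with i Fin.≟ j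
  ... | yes i≡j = ⊥-elim (i≢j i≡j)
  ... | no _    = refl

  counts-∷ : ∀ {a n} (i j : Fin a) (s : Vec (Fin a) n) →
             Vec.lookup (counts (i ∷ s)) j ≡ indicator (i Fin.≟ j) + Vec.lookup (counts s) j
  counts-∷ i j s = begin
    Vec.lookup (counts (i ∷ s)) j                    ≡⟨ counts-lookup (i ∷ s) j ⟩
    occ j (i ∷ s)                                    ≡⟨ occurrences-∷ j i (Vec.toList s) ⟩
    indicator (i Fin.≟ j) + occ j s                  ≡⟨ cong (indicator (i Fin.≟ j) +_) (counts-lookup s j) ⟨
    indicator (i Fin.≟ j) + Vec.lookup (counts s) j  ∎
    where open ≡-Reasoning

  counts-∷-head : ∀ {a n} (i : Fin a) (s : Vec (Fin a) n) {c} → counts (i ∷ s) ≡ c → 1 ≤ Vec.lookup c i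
  counts-∷-head i s refl =
    subst (1 ≤_) (sym (trans (counts-∷ i i s) (cong (_+ Vec.lookup (counts s) i) (indicator-≟-refl i)))) (s≤s z≤n)

  counts-∷-tail : ∀ {a n} (i : Fin a) (s : Vec (Fin a) n) {c} → counts (i ∷ s) ≡ c →
                  counts s ≡ Vec.updateAt c i ℕ.pred
  counts-∷-tail i s refl = vec-ext _ _ pointwise
    where
    pointwise : ∀ j → Vec.lookup (counts s) j ≡ Vec.lookup (Vec.updateAt (counts (i ∷ s)) i ℕ.pred) j
    pointwise j with i Fin.≟ j
    ... | yes refl = sym (trans (VecP.lookup∘updateAt i (counts (i ∷ s)))
                                (cong ℕ.pred (trans (counts-∷ i i s)
                                                    (cong (_+ Vec.lookup (counts s) i) (indicator-≟-refl i)))))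
    ... | no i≢j   = sym (trans (VecP.lookup∘updateAt′ j i (i≢j ∘ sym) (counts (i ∷ s)))
                                (trans (counts-∷ i j s) (cong (_+ Vec.lookup (counts s) j) (indicator-≟-≢ i≢j))))

  hasCounts? : ∀ {a n} (c : Vec ℕ a) → Decidable (λ (s : Vec (Fin a) n) → counts s ≡ c)
  hasCounts? c s = VecP.≡-dec ℕ._≟_ (counts s) c

  -- A word counted for c starts with some letter i with c_i ≥ 1 and continues with a word
  -- counted for c with c_i lowered by one, so the count is ≤ ∑_i c_i · (n-1)! = n!.
  multinomial≤factorial : ∀ {a} n (c : Vec ℕ a) → length (interleavings n c) ≤ n !
  multinomial≤factorial {a} zero c = count-≤-length (hasCounts? c) (words a zero)
  multinomial≤factorial {a} (suc n) c with total c ℕ.≟ suc n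
  ... | no total≢ =
    ≤-trans (≤-reflexive (count-none (hasCounts? c) (All.universal wrong-total (words a (suc n))))) z≤n
    where
    wrong-total : ∀ s → counts s ≢ c
    wrong-total s counts≡c = total≢ (trans (cong total (sym counts≡c)) (total-counts s))
  ... | yes total≡ = begin
    count (hasCounts? c) (words a (suc n))
      ≡⟨ count-words-suc (hasCounts? c) ⟩
    ∑ a (λ i → count (λ s → hasCounts? c (i ∷ s)) (words a n))
      ≤⟨ ∑-mono a first-letter ⟩
    ∑ a (λ i → Vec.lookup c i * n !)   ≡⟨ ∑-*ʳ a (Vec.lookup c) (n !) ⟩
    total c * n !                      ≡⟨ cong (_* n !) total≡ ⟩
    suc n !                            ∎
    where
    open ≤-Reasoning
    first-letter : ∀ i → count (λ s → hasCounts? c (i ∷ s)) (words a n) ≤ Vec.lookup c i * n !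
    first-letter i with Vec.lookup c i in cᵢ
    ... | zero  =
      ≤-reflexive (count-none (λ s → hasCounts? c (i ∷ s)) (All.universal no-word (words a n)))
      where
      no-word : ∀ s → counts (i ∷ s) ≢ c
      no-word s counts≡c with () ← subst (1 ≤_) cᵢ (counts-∷-head i s counts≡c)
    ... | suc k = begin
      count (λ s → hasCounts? c (i ∷ s)) (words a n)
        ≤⟨ count-mono _ (hasCounts? (Vec.updateAt c i ℕ.pred)) (λ s → counts-∷-tail i s) (words a n) ⟩
      length (interleavings n (Vec.updateAt c i ℕ.pred))
        ≤⟨ multinomial≤factorial n (Vec.updateAt c i ℕ.pred) ⟩
      n !                                ≤⟨ m≤m+n (n !) (k * n !) ⟩
      suc k * n !                        ∎

  distinct? : ∀ {a} → Decidable (Distinct {a})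
  distinct? = UniqueDec.unique? Fin._≟_

  distinctExtensions : ∀ {a} → List (Fin a) → ℕ → ℕ
  distinctExtensions {a} p n = count (λ s → distinct? (p ++ Vec.toList s)) (words a n)

  _∈?_ : ∀ {a} (i : Fin a) (p : List (Fin a)) → Dec (i ∈ p)
  i ∈? p = Any.any? (i Fin.≟_) p

  ∑-∈ : ∀ a (p : List (Fin a)) → ∑ a (λ i → indicator (i ∈? p)) ≤ length p
  ∑-∈ a []      = ≤-reflexive (∑-zero a (λ _ → refl))
  ∑-∈ a (x ∷ p) = begin
    ∑ a (λ i → indicator (i ∈? (x ∷ p)))
      ≤⟨ ∑-mono a head-or-tail ⟩
    ∑ a (λ i → indicator (x Fin.≟ i) + indicator (i ∈? p))
      ≡⟨ ∑-+ a _ _ ⟩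
    ∑ a (λ i → indicator (x Fin.≟ i)) + ∑ a (λ i → indicator (i ∈? p))
      ≤⟨ +-mono-≤ (≤-reflexive (∑-indicator-≟ a x)) (∑-∈ a p) ⟩
    suc (length p) ∎
    where
    open ≤-Reasoning
    head-or-tail : ∀ i → indicator (i ∈? (x ∷ p)) ≤ indicator (x Fin.≟ i) + indicator (i ∈? p)
    head-or-tail i with i Fin.≟ x | x Fin.≟ i | i ∈? p
    ... | yes _   | yes _   | _     = s≤s z≤n
    ... | yes i≡x | no x≢i  | _     = ⊥-elim (x≢i (sym i≡x))
    ... | no _    | yes _   | _     = n≤1+n _
    ... | no _    | no _    | yes _ = s≤s z≤n
    ... | no _    | no _    | no _  = z≤n

  ∑-∉ : ∀ a (p : List (Fin a)) → a ∸ length p ≤ ∑ a (λ i → indicator (¬? (i ∈? p)))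
  ∑-∉ a p = begin
    a ∸ length p               ≤⟨ ∸-monoʳ-≤ a (∑-∈ a p) ⟩
    a ∸ in-p                   ≡⟨ cong (_∸ in-p) (sym in-p+not-in-p) ⟩
    in-p + not-in-p ∸ in-p     ≡⟨ m+n∸m≡n in-p not-in-p ⟩
    not-in-p                   ∎
    where
    open ≤-Reasoning
    in-p = ∑ a (λ i → indicator (i ∈? p))
    not-in-p = ∑ a (λ i → indicator (¬? (i ∈? p)))
    exactly-one : ∀ i → indicator (i ∈? p) + indicator (¬? (i ∈? p)) ≡ 1
    exactly-one i with i ∈? p
    ... | yes _ = refl
    ... | no _  = refl
    in-p+not-in-p : in-p + not-in-p ≡ a
    in-p+not-in-p = trans (sym (∑-+ a _ _)) (trans (∑-cong a exactly-one) (∑-ones a))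

  distinct-snoc : ∀ {a} {p : List (Fin a)} {i} → Distinct p → i ∉ p → Distinct (p ++ i ∷ [])
  distinct-snoc dist i∉p =
    AllPairsP.++⁺ dist ([] ∷ []) (All.tabulate (λ x∈p → (λ { refl → i∉p x∈p }) ∷ []))

  -- A distinct prefix p has at least (a - |p|)(a - |p| - 1)⋯ distinct extensions of
  -- length n: there are a - |p| choices for the next letter, then recurse.
  falling≤distinctExtensions : ∀ {a} (p : List (Fin a)) n → Distinct p →
                               falling (a ∸ length p) n ≤ distinctExtensions p n
  falling≤distinctExtensions {a} p zero dist =
    count-∈ (λ s → distinct? (p ++ Vec.toList s)) (here refl) (subst Distinct (sym (++-identityʳ p)) dist)
  falling≤distinctExtensions {a} p (suc n) dist = begin
    (a ∸ length p) * falling (ℕ.pred (a ∸ length p)) n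
      ≤⟨ *-monoˡ-≤ _ (∑-∉ a p) ⟩
    ∑ a (λ i → indicator (¬? (i ∈? p))) * falling (ℕ.pred (a ∸ length p)) n
      ≤⟨ ∑-≥-count a (λ i → ¬? (i ∈? p)) _ _ next-letter ⟩
    ∑ a (λ i → count (λ s → distinct? (p ++ Vec.toList (i ∷ s))) (words a n))
      ≡⟨ sym (count-words-suc (λ s → distinct? (p ++ Vec.toList s))) ⟩
    distinctExtensions p (suc n) ∎
    where
    open ≤-Reasoning
    next-letter : ∀ i → i ∉ p → falling (ℕ.pred (a ∸ length p)) n
                                ≤ count (λ s → distinct? (p ++ Vec.toList (i ∷ s))) (words a n)
    next-letter i i∉p = begin
      falling (ℕ.pred (a ∸ length p)) n
        ≡⟨ cong (λ m → falling m n) (trans (pred[m∸n]≡m∸[1+n] a (length p))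
                                            (cong (a ∸_) (trans (+-comm 1 _) (sym (length-++ p))))) ⟩
      falling (a ∸ length (p ++ i ∷ [])) n
        ≤⟨ falling≤distinctExtensions (p ++ i ∷ []) n (distinct-snoc dist i∉p) ⟩
      distinctExtensions (p ++ i ∷ []) n
        ≤⟨ count-mono _ _ (λ s → subst Distinct (++-assoc p (i ∷ []) (Vec.toList s))) (words a n) ⟩
      count (λ s → distinct? (p ++ Vec.toList (i ∷ s))) (words a n) ∎

  module _ {A : Set} where

    cut-length : ∀ {a} (c : Vec ℕ a) (xs : List A) b → length (Vec.lookup (cut c xs) b) ≤ Vec.lookup c b
    cut-length (c ∷ cs) xs Fin.zero    = ≤-trans (≤-reflexive (length-take c xs)) (m⊓n≤m c _)
    cut-length (c ∷ cs) xs (Fin.suc b) = cut-length cs (List.drop c xs) b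

    take-+ : ∀ m r (xs : List A) {k} → k ∈ List.take (m + r) xs →
             k ∈ List.take m xs ⊎ k ∈ List.take r (List.drop m xs)
    take-+ zero    r xs       k∈ = inj₂ k∈
    take-+ (suc m) r (x ∷ xs) (here k≡x) = inj₁ (here k≡x)
    take-+ (suc m) r (x ∷ xs) (there k∈) with take-+ m r xs k∈
    ... | inj₁ k∈′ = inj₁ (there k∈′)
    ... | inj₂ k∈′ = inj₂ k∈′

    cut-covers : ∀ {a} (c : Vec ℕ a) (xs : List A) {k} → k ∈ List.take (total c) xs →
                 Σ (Fin a) (λ b → k ∈ Vec.lookup (cut c xs) b)
    cut-covers []       xs ()
    cut-covers (c ∷ cs) xs k∈ with take-+ c (total cs) xs k∈
    ... | inj₁ k∈′ = Fin.zero , k∈′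
    ... | inj₂ k∈′ with cut-covers cs (List.drop c xs) k∈′
    ...   | b , k∈b = Fin.suc b , k∈b

    singleton-∈ : ∀ {k : A} l → length l ≤ 1 → k ∈ l → l ≡ k ∷ []
    singleton-∈ (y ∷ [])     _         (here refl) = refl
    singleton-∈ (y ∷ z ∷ l) (s≤s ()) _

    orient-singleton : ∀ (σ : Sign) (k : A) → orient σ (k ∷ []) ≡ k ∷ []
    orient-singleton Sign.- k = refl
    orient-singleton Sign.+ k = refl

    orient-length : ∀ (σ : Sign) (l : List A) → length (orient σ l) ≡ length l
    orient-length Sign.- l = length-reverse l
    orient-length Sign.+ l = refl

  interleave-singletons : ∀ {a n m} (box : Fin n → Fin a) (ps : Vec (List (Fin n)) a)
    (v : Vec (Fin n) m) → Distinct (Vec.toList v) →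
    (∀ k → k ∈ Vec.toList v → Vec.lookup ps (box k) ≡ k ∷ []) →
    interleave ps (Vec.map box v) ≡ Vec.toList v
  interleave-singletons box ps []      _             alone = refl
  interleave-singletons box ps (k ∷ v) (k∉v ∷ dist) alone rewrite alone k (here refl) =
    cong (k ∷_) (interleave-singletons box (ps Vec.[ box k ]≔ []) v dist alone′)
    where
    alone′ : ∀ k′ → k′ ∈ Vec.toList v → Vec.lookup (ps Vec.[ box k ]≔ []) (box k′) ≡ k′ ∷ []
    alone′ k′ k′∈v with box k′ Fin.≟ box k
    ... | yes same-box = ⊥-elim (All.lookup k∉v k′∈v (∷-injectiveˡ (begin
      k ∷ []                    ≡⟨ alone k (here refl) ⟨
      Vec.lookup ps (box k)     ≡⟨ cong (Vec.lookup ps) same-box ⟨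
      Vec.lookup ps (box k′)    ≡⟨ alone k′ (there k′∈v) ⟩
      k′ ∷ []                   ∎)))
      where open ≡-Reasoning
    ... | no other-box = trans (VecP.lookup∘update′ other-box ps []) (alone k′ (there k′∈v))

  ≤1-≤ : ∀ x y → x ≤ 1 → (1 ≤ x → 1 ≤ y) → x ≤ y
  ≤1-≤ zero          y _        _    = z≤n
  ≤1-≤ (suc zero)    y _        x⇒y  = x⇒y (s≤s z≤n)
  ≤1-≤ (suc (suc _)) y (s≤s ()) _

  -- An injective drop f (no box gets two cards) realises every arrangement w: each card
  -- k is alone in its packet box k, and the word box ∘ w is an interleaving that lays
  -- out w and has the same letter counts as f.
  module InjectiveDrop {a n : ℕ} (x : Vec Sign a) (f : Vec (Fin a) n)
                       (f-distinct : Distinct (Vec.toList f)) where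

    c : Vec ℕ a
    c = counts f

    ps : Vec (List (Fin n)) a
    ps = packets n x c

    ps-lookup : ∀ b → Vec.lookup ps b ≡ orient (Vec.lookup x b) (Vec.lookup (cut c (deck n)) b)
    ps-lookup b = VecP.lookup-zipWith orient b x (cut c (deck n))

    size≤1 : ∀ b → Vec.lookup c b ≤ 1
    size≤1 b = ≤-trans (≤-reflexive (counts-lookup f b)) (occurrences-distinct b (Vec.toList f) f-distinct)

    whole-deck : List.take (total c) (deck n) ≡ deck n
    whole-deck rewrite total-counts f = take-all n (List.allFin n) (≤-reflexive (length-tabulate (λ i → i)))

    alone : ∀ k → Σ (Fin a) (λ b → Vec.lookup ps b ≡ k ∷ [])
    alone k with cut-covers c (deck n) (subst (k ∈_) (sym whole-deck) (∈-allFin k))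
    ... | b , k∈b = b , (begin
      Vec.lookup ps b                                              ≡⟨ ps-lookup b ⟩
      orient (Vec.lookup x b) (Vec.lookup (cut c (deck n)) b)
        ≡⟨ cong (orient (Vec.lookup x b))
                (singleton-∈ _ (≤-trans (cut-length c (deck n) b) (size≤1 b)) k∈b) ⟩
      orient (Vec.lookup x b) (k ∷ [])                             ≡⟨ orient-singleton (Vec.lookup x b) k ⟩
      k ∷ []                                                       ∎)
      where open ≡-Reasoning

    box : Fin n → Fin a
    box k = proj₁ (alone k)

    box-alone : ∀ k → Vec.lookup ps (box k) ≡ k ∷ []
    box-alone k = proj₂ (alone k)

    box-injective : ∀ {k k′} → box k ≡ box k′ → k ≡ k′
    box-injective {k} {k′} same = ∷-injectiveˡ
      (trans (sym (box-alone k)) (trans (cong (Vec.lookup ps) same) (box-alone k′)))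

    used-box-nonempty : ∀ {m} (v : Vec (Fin n) m) b → 1 ≤ occ b (Vec.map box v) → 1 ≤ Vec.lookup c b
    used-box-nonempty v b used
      with ∈-map⁻ box (subst (b ∈_) (VecP.toList-map box v) (occurrences-∈ b _ used))
    ... | k , _ , refl = begin
      1                                          ≡⟨ sym (cong length (box-alone k)) ⟩
      length (Vec.lookup ps (box k))             ≡⟨ cong length (ps-lookup (box k)) ⟩
      length (orient (Vec.lookup x (box k)) _)   ≡⟨ orient-length (Vec.lookup x (box k)) _ ⟩
      length (Vec.lookup (cut c (deck n)) (box k)) ≤⟨ cut-length c (deck n) (box k) ⟩
      Vec.lookup c (box k)                       ∎
      where open ≤-Reasoning

    box-counts : (v : Vec (Fin n) n) → Distinct (Vec.toList v) → counts (Vec.map box v) ≡ c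
    box-counts v v-distinct = vec-ext _ _ (λ b →
        trans (counts-lookup s b) (trans (∑-≤-≡ a occ-s≤occ-f equal-totals b) (sym (counts-lookup f b))))
      where
      s = Vec.map box v
      s-distinct : Distinct (Vec.toList s)
      s-distinct = subst Distinct (sym (VecP.toList-map box v)) (UniqueP.map⁺ box-injective v-distinct)
      occ-s≤occ-f : ∀ b → occ b s ≤ occ b f
      occ-s≤occ-f b = ≤1-≤ _ _ (occurrences-distinct b (Vec.toList s) s-distinct)
                        (subst (1 ≤_) (counts-lookup f b) ∘ used-box-nonempty v b)
      equal-totals : ∑ a (λ b → occ b s) ≡ ∑ a (λ b → occ b f)
      equal-totals = begin
        ∑ a (λ b → occ b s)           ≡⟨ ∑-cong a (λ b → sym (counts-lookup s b)) ⟩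
        total (counts s)              ≡⟨ total-counts s ⟩
        n                             ≡⟨ sym (total-counts f) ⟩
        total (counts f)              ≡⟨ ∑-cong a (counts-lookup f) ⟩
        ∑ a (λ b → occ b f)           ∎
        where open ≡-Reasoning

    realises : ∀ w → w ∈ Sn n →
      1 ≤ count (λ s → ≡-dec Fin._≟_ (interleave ps s) w) (interleavings n c)
    realises w w∈Sn with ∈-filter⁻ distinct? {xs = List.map Vec.toList (words n n)} w∈Sn
    ... | w∈words , w-distinct with ∈-map⁻ Vec.toList w∈words
    ... | v , _ , refl =
      count-∈ _ (∈-filter⁺ (hasCounts? c) (∈-words (Vec.map box v)) (box-counts v w-distinct))
                (interleave-singletons box ps v w-distinct (λ k _ → box-alone k))

module Rationals where

  open import Data.Nat using (_^_; z≤n; s≤s)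
  open import Data.Sum using (inj₁; inj₂)
  import Data.Nat.Properties as ℕP
  open import Data.Integer as ℤ using (+_)
  import Data.Integer.Properties as ℤP
  open import Data.Integer.Solver using (module +-*-Solver)
  open import Data.Rational using (ℚ; 0ℚ; 1ℚ; _+_; _*_; -_; _-_; _≤_; _⊔_; toℚᵘ; NonNegative; nonNegative)
  open import Data.Rational.Properties
  import Data.Rational.Unnormalised as ℚᵘ
  import Data.Rational.Unnormalised.Properties as ℚᵘP
  open import Data.Nat.Solver using () renaming (module +-*-Solver to ℕ-Solver)

  toℚᵘ-frac : ∀ p d .{{_ : NonZero d}} → toℚᵘ (frac p d) ℚᵘ.≃ ℚᵘ.mkℚᵘ (+ p) (ℕ.pred d)
  toℚᵘ-frac p (suc d) = toℚᵘ-fromℚᵘ (ℚᵘ.mkℚᵘ (+ p) d)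

  frac-≤ : ∀ p q d e .{{_ : NonZero d}} .{{_ : NonZero e}} →
           p ℕ.* e ℕ.≤ q ℕ.* d → frac p d ≤ frac q e
  frac-≤ p q d@(suc _) e@(suc _) pe≤qd = toℚᵘ-cancel-≤
    (ℚᵘP.≤-respˡ-≃ (ℚᵘP.≃-sym (toℚᵘ-frac p d)) (ℚᵘP.≤-respʳ-≃ (ℚᵘP.≃-sym (toℚᵘ-frac q e))
      (ℚᵘ.*≤* (subst₂ ℤ._≤_ (ℤP.pos-* p e) (ℤP.pos-* q d) (ℤ.+≤+ pe≤qd)))))

  frac-≡ : ∀ p q d e .{{_ : NonZero d}} .{{_ : NonZero e}} →
           p ℕ.* e ≡ q ℕ.* d → frac p d ≡ frac q e
  frac-≡ p q d@(suc _) e@(suc _) pe≡qd = toℚᵘ-injective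
    (ℚᵘP.≃-trans (toℚᵘ-frac p d) (ℚᵘP.≃-trans
      (ℚᵘ.*≡* (trans (sym (ℤP.pos-* p e)) (trans (cong +_ pe≡qd) (ℤP.pos-* q d))))
      (ℚᵘP.≃-sym (toℚᵘ-frac q e))))

  frac-* : ∀ p q d e .{{_ : NonZero d}} .{{_ : NonZero e}} →
           frac p d * frac q e ≡ frac (p ℕ.* q) (d ℕ.* e)
  frac-* p q d@(suc _) e@(suc _) = toℚᵘ-injective
    (ℚᵘP.≃-trans (toℚᵘ-homo-* (frac p d) (frac q e))
    (ℚᵘP.≃-trans (ℚᵘP.*-cong (toℚᵘ-frac p d) (toℚᵘ-frac q e))
    (ℚᵘP.≃-trans (ℚᵘ.*≡* (cong (ℤ._* + (d ℕ.* e)) (sym (ℤP.pos-* p q))))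
     (ℚᵘP.≃-sym (toℚᵘ-frac (p ℕ.* q) (d ℕ.* e))))))

  frac-+ : ∀ m k → frac (m ℕ.+ k) 1 ≡ frac m 1 + frac k 1
  frac-+ m k = toℚᵘ-injective
    (ℚᵘP.≃-trans (toℚᵘ-frac (m ℕ.+ k) 1)
    (ℚᵘP.≃-trans (ℚᵘ.*≡* cross)
    (ℚᵘP.≃-sym (ℚᵘP.≃-trans (toℚᵘ-homo-+ (frac m 1) (frac k 1))
                             (ℚᵘP.+-cong (toℚᵘ-frac m 1) (toℚᵘ-frac k 1))))))
    where
    open +-*-Solver
    cross : + (m ℕ.+ k) ℤ.* + 1 ≡ (+ m ℤ.* + 1 ℤ.+ + k ℤ.* + 1) ℤ.* + 1
    cross rewrite ℤP.pos-+ m k =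
      solve 2 (λ x y → (x :+ y) :* con (+ 1) := (x :* con (+ 1) :+ y :* con (+ 1)) :* con (+ 1)) refl (+ m) (+ k)

  frac-complement : ∀ i k d .{{_ : NonZero d}} → d ≡ i ℕ.+ k → 1ℚ - frac i d ≡ frac k d
  frac-complement i k d@(suc _) d≡i+k = toℚᵘ-injective
    (ℚᵘP.≃-trans (toℚᵘ-homo-+ 1ℚ (- frac i d))
    (ℚᵘP.≃-trans (ℚᵘP.+-cong (ℚᵘP.≃-refl {ℚᵘ.1ℚᵘ})
                             (ℚᵘP.≃-trans (toℚᵘ-homo‿- (frac i d)) (ℚᵘP.-‿cong (toℚᵘ-frac i d))))
    (ℚᵘP.≃-trans (ℚᵘ.*≡* cross) (ℚᵘP.≃-sym (toℚᵘ-frac k d)))))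
    where
    open +-*-Solver
    +d≡ : + d ≡ + i ℤ.+ + k
    +d≡ = trans (cong +_ d≡i+k) (ℤP.pos-+ i k)
    cross : (+ 1 ℤ.* + d ℤ.+ ℤ.- (+ i) ℤ.* + 1) ℤ.* + d ≡ + k ℤ.* + (1 ℕ.* d)
    cross = begin
      (+ 1 ℤ.* + d ℤ.+ ℤ.- (+ i) ℤ.* + 1) ℤ.* + d
        ≡⟨ cong (λ z → (+ 1 ℤ.* z ℤ.+ ℤ.- (+ i) ℤ.* + 1) ℤ.* z) +d≡ ⟩
      (+ 1 ℤ.* (+ i ℤ.+ + k) ℤ.+ ℤ.- (+ i) ℤ.* + 1) ℤ.* (+ i ℤ.+ + k)
        ≡⟨ solve 2 (λ x y → (con (+ 1) :* (x :+ y) :+ (:- x) :* con (+ 1)) :* (x :+ y) := y :* (x :+ y))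
                 refl (+ i) (+ k) ⟩
      + k ℤ.* (+ i ℤ.+ + k)
        ≡⟨ cong (λ z → + k ℤ.* z) (trans (sym +d≡) (cong +_ (sym (ℕP.*-identityˡ d)))) ⟩
      + k ℤ.* + (1 ℕ.* d) ∎
      where open ≡-Reasoning

  frac-zero : ∀ d .{{_ : NonZero d}} → frac 0 d ≡ 0ℚ
  frac-zero d = frac-≡ 0 0 d 1 refl

  frac-nonneg : ∀ p d → 0ℚ ≤ frac p d
  frac-nonneg p zero    = ≤-refl
  frac-nonneg p (suc d) = nonNegative⁻¹ _ {{normalize-nonNeg p (suc d)}}

  -- The same, as the instance form required by the monotonicity lemmas of ℚ.
  frac-nonNegative : ∀ p d → NonNegative (frac p d)
  frac-nonNegative p d = nonNegative (frac-nonneg p d)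

  frac-cancelˡ : ∀ k p d .{{_ : NonZero k}} .{{_ : NonZero d}} → frac (k ℕ.* p) (k ℕ.* d) ≡ frac p d
  frac-cancelˡ k@(suc _) p d@(suc _) = frac-≡ (k ℕ.* p) p (k ℕ.* d) d (reorder k p d)
    where
    open ℕ-Solver
    reorder : ∀ k p d → k ℕ.* p ℕ.* d ≡ p ℕ.* (k ℕ.* d)
    reorder = solve 3 (λ k p d → k :* p :* d := p :* (k :* d)) refl

  frac-rescale : ∀ J A F .{{_ : NonZero A}} .{{_ : NonZero F}} →
                 frac J 1 * (frac 1 A * frac 1 F) * frac F 1 ≡ frac J A
  frac-rescale J A@(suc _) F@(suc _) = begin
    frac J 1 * (frac 1 A * frac 1 F) * frac F 1  ≡⟨ cong (λ q → frac J 1 * q * frac F 1) (frac-* 1 1 A F) ⟩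
    frac J 1 * frac 1 (A ℕ.* F) * frac F 1       ≡⟨ cong (_* frac F 1) (frac-* J 1 1 (A ℕ.* F)) ⟩
    frac (J ℕ.* 1) (1 ℕ.* (A ℕ.* F)) * frac F 1  ≡⟨ frac-* (J ℕ.* 1) F (1 ℕ.* (A ℕ.* F)) 1 ⟩
    frac (J ℕ.* 1 ℕ.* F) (1 ℕ.* (A ℕ.* F) ℕ.* 1)
      ≡⟨ frac-≡ (J ℕ.* 1 ℕ.* F) J (1 ℕ.* (A ℕ.* F) ℕ.* 1) A (reorder J A F) ⟩
    frac J A                                     ∎
    where
    open ≡-Reasoning
    open ℕ-Solver
    reorder : ∀ J A F → J ℕ.* 1 ℕ.* F ℕ.* A ≡ J ℕ.* (1 ℕ.* (A ℕ.* F) ℕ.* 1)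
    reorder = solve 3 (λ J A F → J :* con 1 :* F :* A := J :* (con 1 :* (A :* F) :* con 1)) refl

  reciprocal-≤ : ∀ N K F → 1 ℕ.≤ N → N ℕ.≤ K → K ℕ.≤ F → frac 1 F ≤ frac N K
  reciprocal-≤ N@(suc _) K@(suc _) F@(suc _) _ _ K≤F =
    frac-≤ 1 N F K (ℕP.≤-trans (ℕP.≤-reflexive (ℕP.*-identityˡ K))
                   (ℕP.≤-trans K≤F (ℕP.m≤n*m F N)))

  1-‿antimono : ∀ {p q} → p ≤ q → 1ℚ - q ≤ 1ℚ - p
  1-‿antimono p≤q = +-monoʳ-≤ 1ℚ (neg-antimono-≤ p≤q)

  sumℚ-≥-count : ∀ {A : Set} {P : A → Set} (P? : Decidable P) (g : A → ℚ) (q : ℚ) →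
    (∀ x → 0ℚ ≤ g x) → (∀ x → P x → q ≤ g x) → ∀ l →
    frac (count P? l) 1 * q ≤ sumℚ (List.map g l)
  sumℚ-≥-count P? g q g≥0 q≤g []      = ≤-reflexive (*-zeroˡ q)
  sumℚ-≥-count P? g q g≥0 q≤g (x ∷ l) with P? x
  ... | yes Px = begin
    frac (suc k) 1 * q              ≡⟨ cong (_* q) (frac-+ 1 k) ⟩
    (1ℚ + frac k 1) * q             ≡⟨ *-distribʳ-+ q 1ℚ (frac k 1) ⟩
    1ℚ * q + frac k 1 * q           ≡⟨ cong (_+ frac k 1 * q) (*-identityˡ q) ⟩
    q + frac k 1 * q                ≤⟨ +-mono-≤ (q≤g x Px) (sumℚ-≥-count P? g q g≥0 q≤g l) ⟩
    g x + sumℚ (List.map g l)       ∎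
    where
    open ≤-Reasoning
    k = count P? l
  ... | no _ = begin
    frac (count P? l) 1 * q         ≡⟨ sym (+-identityˡ _) ⟩
    0ℚ + frac (count P? l) 1 * q    ≤⟨ +-mono-≤ (g≥0 x) (sumℚ-≥-count P? g q g≥0 q≤g l) ⟩
    g x + sumℚ (List.map g l)       ∎
    where open ≤-Reasoning

  maxℚ-≤ : ∀ (qs : List ℚ) b → 0ℚ ≤ b → All (_≤ b) qs → maxℚ qs ≤ b
  maxℚ-≤ []       b 0≤b _            = 0≤b
  maxℚ-≤ (q ∷ qs) b 0≤b (q≤b ∷ qs≤b) = go qs qs≤b
    where
    go : ∀ rs → All (_≤ b) rs → List.foldr _⊔_ q rs ≤ b
    go []       _            = q≤b
    go (r ∷ rs) (r≤b ∷ rs≤b) = ⊔-lub r≤b (go rs rs≤b)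

  complementProduct : ℕ → List ℕ → ℚ
  complementProduct a is = prodℚ (List.map (λ i → 1ℚ - frac i a) is)

  from : ℕ → ℕ → List ℕ
  from k zero    = []
  from k (suc m) = k ∷ from (suc k) m

  applyUpTo-from : ∀ m k (h : ℕ → ℕ) → (∀ i → h i ≡ k ℕ.+ i) → List.applyUpTo h m ≡ from k m
  applyUpTo-from zero    k h h≡ = refl
  applyUpTo-from (suc m) k h h≡ = cong₂ _∷_ (trans (h≡ 0) (ℕP.+-identityʳ k))
    (applyUpTo-from m (suc k) (h ∘ suc) (λ i → trans (h≡ (suc i)) (ℕP.+-suc k i)))

  -- ∏_{i=j+1}^{j+m} (1 - i/a) ≤ (a-j-1)(a-j-2)⋯(a-j-m) / aᵐ for j < a: each factor
  -- equals (a-i)/a, except that once i reaches a the product vanishes.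
  complementProduct-from : ∀ a .{{_ : NonZero a}} j m → j ℕ.< a →
    complementProduct a (from (suc j) m) ≤ frac (falling (a ℕ.∸ suc j) m) (a ^ m)
  complementProduct-from a j zero    j<a = ≤-refl
  complementProduct-from a j (suc m) j<a with ℕP.m≤n⇒m<n∨m≡n j<a
  ... | inj₂ 1+j≡a = begin
    (1ℚ - frac (suc j) a) * rest  ≡⟨ cong (_* rest) vanishing-factor ⟩
    0ℚ * rest                     ≡⟨ *-zeroˡ rest ⟩
    0ℚ                            ≤⟨ frac-nonneg (falling (a ℕ.∸ suc j) (suc m)) (a ^ suc m) ⟩
    frac (falling (a ℕ.∸ suc j) (suc m)) (a ^ suc m) ∎
    where
    open ≤-Reasoning
    rest = complementProduct a (from (suc (suc j)) m)
    vanishing-factor : 1ℚ - frac (suc j) a ≡ 0ℚ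
    vanishing-factor = trans (frac-complement (suc j) 0 a (trans (sym 1+j≡a) (sym (ℕP.+-identityʳ (suc j)))))
                             (frac-zero a)
  ... | inj₁ 1+j<a = begin
    (1ℚ - frac (suc j) a) * rest
      ≡⟨ cong (_* rest) (frac-complement (suc j) k a (sym (ℕP.m+[n∸m]≡n (ℕP.<⇒≤ 1+j<a)))) ⟩
    frac k a * rest
      ≤⟨ *-monoˡ-≤-nonNeg (frac k a) {{frac-nonNegative k a}} (complementProduct-from a (suc j) m 1+j<a) ⟩
    frac k a * frac (falling (a ℕ.∸ suc (suc j)) m) (a ^ m)
      ≡⟨ frac-* k _ a (a ^ m) ⟩
    frac (k ℕ.* falling (a ℕ.∸ suc (suc j)) m) (a ^ suc m)
      ≡⟨ cong (λ r → frac (k ℕ.* falling r m) (a ^ suc m)) (sym (ℕP.pred[m∸n]≡m∸[1+n] a (suc j))) ⟩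
    frac (falling k (suc m)) (a ^ suc m) ∎
    where
    open ≤-Reasoning
    k = a ℕ.∸ suc j
    rest = complementProduct a (from (suc (suc j)) m)
    instance
      a^m≢0 : NonZero (a ^ m)
      a^m≢0 = ℕP.m^n≢0 a m

  complementProduct≤falling : ∀ a .{{_ : NonZero a}} n →
    complementProduct a (List.drop 1 (List.upTo n)) ≤ frac (falling a n) (a ^ n)
  complementProduct≤falling a         zero    = ≤-refl
  complementProduct≤falling a@(suc _) (suc m) = begin
    complementProduct a (List.applyUpTo suc m)
      ≡⟨ cong (complementProduct a) (applyUpTo-from m 1 suc (λ _ → refl)) ⟩
    complementProduct a (from 1 m)
      ≤⟨ complementProduct-from a 0 m (s≤s z≤n) ⟩
    frac (falling (ℕ.pred a) m) (a ^ m)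
      ≡⟨ sym (frac-cancelˡ a _ (a ^ m)) ⟩
    frac (falling a (suc m)) (a ^ suc m) ∎
    where
    open ≤-Reasoning
    instance
      a^m≢0 : NonZero (a ^ m)
      a^m≢0 = ℕP.m^n≢0 a m

  falling≤^ : ∀ m n → falling m n ℕ.≤ m ^ n
  falling≤^ m zero    = ℕP.≤-refl
  falling≤^ m (suc n) =
    ℕP.*-monoʳ-≤ m (ℕP.≤-trans (falling≤^ (ℕ.pred m) n) (ℕP.^-monoˡ-≤ n (ℕP.pred[n]≤n {m})))

  complementProduct≤1 : ∀ a .{{_ : NonZero a}} n →
                        complementProduct a (List.drop 1 (List.upTo n)) ≤ 1ℚ
  complementProduct≤1 a n = ≤-trans (complementProduct≤falling a n)
    (frac-≤ (falling a n) 1 (a ^ n) 1 {{ℕP.m^n≢0 a n}}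
            (subst₂ ℕ._≤_ (sym (ℕP.*-identityʳ _)) (sym (ℕP.*-identityˡ _)) (falling≤^ a n)))

open Combinatorics using (distinct?; distinctExtensions; falling≤distinctExtensions;
                          count-≤-length; multinomial≤factorial; module InjectiveDrop)
open Rationals
open import Data.Nat using (_^_; _!)
import Data.Nat.Properties as ℕP
open import Data.Rational using (ℚ; 0ℚ; 1ℚ; _*_; _-_; _≤_)
open import Data.List.Properties using (≡-dec)
open import Data.Rational.Properties using (module ≤-Reasoning; *-monoˡ-≤-nonNeg; *-monoʳ-≤-nonNeg;
                                            nonNeg*nonNeg⇒nonNeg; nonNegative⁻¹; +-inverseʳ)
import Data.List.Relation.Unary.All.Properties as AllP

Px≥injectiveDrops : ∀ a n .{{_ : NonZero a}} (x : Vec Sign a) (w : List (Fin n)) → w ∈ Sn n →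
  frac (distinctExtensions {a} [] n) 1 * (frac 1 (a ^ n) * frac 1 (n !)) ≤ Px n x w
Px≥injectiveDrops a n x w w∈Sn =
  sumℚ-≥-count (λ f → distinct? (Vec.toList f)) contribution _
               contribution≥0 injective-contribution (words a n)
  where
  contribution : Vec (Fin a) n → ℚ
  contribution f = frac 1 (a ^ n) * Qint n x (counts f) w

  realisations : Vec (Fin a) n → ℕ
  realisations f = count (λ s → ≡-dec Fin._≟_ (interleave (packets n x (counts f)) s) w)
                         (interleavings n (counts f))

  contribution≥0 : ∀ f → 0ℚ ≤ contribution f
  contribution≥0 f = nonNegative⁻¹ _ {{nonNeg*nonNeg⇒nonNeg
    (frac 1 (a ^ n)) {{frac-nonNegative 1 (a ^ n)}}
    (Qint n x (counts f) w) {{frac-nonNegative (realisations f) (length (interleavings n (counts f)))}}}}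

  injective-contribution : ∀ f → Distinct (Vec.toList f) → frac 1 (a ^ n) * frac 1 (n !) ≤ contribution f
  injective-contribution f f-distinct =
    *-monoˡ-≤-nonNeg (frac 1 (a ^ n)) {{frac-nonNegative 1 (a ^ n)}}
      (reciprocal-≤ (realisations f) _ (n !) (InjectiveDrop.realises x f f-distinct w w∈Sn)
                    (count-≤-length _ (interleavings n (counts f)))
                    (multinomial≤factorial n (counts f)))

complementProduct≤n!Px : ∀ a n .{{_ : NonZero a}} (x : Vec Sign a) (w : List (Fin n)) → w ∈ Sn n →
  complementProduct a (List.drop 1 (List.upTo n)) ≤ Px n x w * frac (n !) 1
complementProduct≤n!Px a n x w w∈Sn = begin
  complementProduct a (List.drop 1 (List.upTo n))
    ≤⟨ complementProduct≤falling a n ⟩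
  frac (falling a n) (a ^ n)
    ≤⟨ frac-≤ _ _ (a ^ n) (a ^ n) (ℕP.*-monoˡ-≤ (a ^ n) (falling≤distinctExtensions [] n [])) ⟩
  frac injective (a ^ n)
    ≡⟨ frac-rescale injective (a ^ n) (n !) ⟨
  frac injective 1 * (frac 1 (a ^ n) * frac 1 (n !)) * frac (n !) 1
    ≤⟨ *-monoʳ-≤-nonNeg (frac (n !) 1) {{frac-nonNegative (n !) 1}} (Px≥injectiveDrops a n x w w∈Sn) ⟩
  Px n x w * frac (n !) 1
    ∎
  where
  open ≤-Reasoning
  injective = distinctExtensions {a} [] n
  instance
    a^n≢0 : NonZero (a ^ n)
    a^n≢0 = ℕP.m^n≢0 a n
    n!≢0 : NonZero (n !)
    n!≢0 = n ℕP.!≢0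

theorem4p4 : (a n : ℕ) → .{{_ : NonZero a}} → (x : Vec Sign a) →
    sep n (Px n x) ≤ bound a n
theorem4p4 a n x = maxℚ-≤ _ (bound a n) bound≥0 (AllP.map⁺ (All.tabulate each-arrangement))
  where
  each-arrangement : ∀ {w} → w ∈ Sn n → 1ℚ - Px n x w * frac (n !) 1 ≤ bound a n
  each-arrangement w∈Sn = 1-‿antimono (complementProduct≤n!Px a n x _ w∈Sn)
  bound≥0 : 0ℚ ≤ bound a n
  bound≥0 = subst (_≤ bound a n) (+-inverseʳ 1ℚ) (1-‿antimono (complementProduct≤1 a n))
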